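{- For every integer $r\ge2$, let $B_r$ be a finite constant and $G_{r,1},G_{r,2},\ldots$ graphs such that for every $m\ge1$: $\omega(G_{r,m})=r$, $\chi(G_{r,m})\ge m$, and every induced subgraph $H$ of $G_{r,m}$ with $\omega(H)\le r-1$ satisfies $\chi(H)\le B_r$; let $T_r$ be a connected triangle-free graph with $\omega(T_r)=2$ and $\chi(T_r)=r$. Set $X_{r,m}=G_{r,m}\cup T_r$ (disjoint union) and $\mathcal{C}_r=\{X_{r,m}:m\ge1\}$. Then for every integer $r\ge2$, the class $\mathcal{H}_r=\operatorname{Ind}(\mathcal{C}_r)$ is $(r-1)$-good.
   Context: All graphs are finite, simple and undirected; $\chi$ denotes chromatic number and $\omega$ clique number, with $\chi(\emptyset)=\omega(\emptyset)=0$. For a graph class $\mathcal{A}$, $\operatorname{Ind}(\mathcal{A})$ is the set of all graphs that are induced subgraphs of some member of $\mathcal{A}$. For an integer $n$, $\chi^{(n)}(G)$ is the maximum chromatic number of an induced subgraph $H$ of $G$ with $\omega(H)\le n$. A class $\mathcal{F}$ is $n$-good if it is hereditary (closed under induced subgraphs) and there is a constant $m$ (depending on $\mathcal{F}$ and $n$) with $\chi^{(n)}(G)\le m$ for all $G\in\mathcal{F}$. -}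

module Defs where

open import Data.Nat using (ℕ; zero; suc; _+_; _≤_; _∸_)
open import Data.Fin using (Fin; splitAt)
open import Data.Bool using (Bool; true; false)
open import Data.Sum using (_⊎_; inj₁; inj₂)
open import Data.Product using (Σ; ∃; _×_; _,_)
open import Relation.Binary.PropositionalEquality using (_≡_; _≢_; refl)
open import Relation.Nullary using (¬_)

record Graph : Set where
  field
    size  : ℕ
    adj   : Fin size → Fin size → Bool
    sym   : ∀ u v → adj u v ≡ adj v u
    irrefl : ∀ u → adj u u ≡ false

open Graph public

Vertex : Graph → Set
Vertex G = Fin (size G)

Edge : (G : Graph) → Vertex G → Vertex G → Set
Edge G u v = adj G u v ≡ true

Colorable : Graph → ℕ → Set
Colorable G k = Σ (Vertex G → Fin k) λ c → ∀ u v → Edge G u v → c u ≢ c v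

ChiLe : Graph → ℕ → Set
ChiLe G k = Colorable G k

ChiGe : Graph → ℕ → Set
ChiGe G m = ∀ k → Colorable G k → m ≤ k

ChiEq : Graph → ℕ → Set
ChiEq G r = ChiLe G r × ChiGe G r

HasClique : Graph → ℕ → Set
HasClique G k = Σ (Fin k → Vertex G) λ f → ∀ i j → i ≢ j → Edge G (f i) (f j)

OmegaLe : Graph → ℕ → Set
OmegaLe G n = ¬ HasClique G (suc n)

OmegaEq : Graph → ℕ → Set
OmegaEq G r = HasClique G r × OmegaLe G r

InducedSub : Graph → Graph → Set
InducedSub H G = Σ (Vertex H → Vertex G) λ f →
  (∀ u v → f u ≡ f v → u ≡ v) × (∀ u v → adj H u v ≡ adj G (f u) (f v))

data Reach (G : Graph) : Vertex G → Vertex G → Set where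
  here : ∀ {u} → Reach G u u
  step : ∀ {u w v} → Edge G u w → Reach G w v → Reach G u v

Connected : Graph → Set
Connected G = ∀ u v → Reach G u v

TriangleFree : Graph → Set
TriangleFree G = ¬ HasClique G 3

module _ {n₁ n₂ : ℕ} (a₁ : Fin n₁ → Fin n₁ → Bool) (a₂ : Fin n₂ → Fin n₂ → Bool) where
  sumAdj : Fin n₁ ⊎ Fin n₂ → Fin n₁ ⊎ Fin n₂ → Bool
  sumAdj (inj₁ x) (inj₁ y) = a₁ x y
  sumAdj (inj₁ x) (inj₂ y) = false
  sumAdj (inj₂ x) (inj₁ y) = false
  sumAdj (inj₂ x) (inj₂ y) = a₂ x y

  sumAdj-sym : (∀ x y → a₁ x y ≡ a₁ y x) → (∀ x y → a₂ x y ≡ a₂ y x) →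
               ∀ p q → sumAdj p q ≡ sumAdj q p
  sumAdj-sym s₁ s₂ (inj₁ x) (inj₁ y) = s₁ x y
  sumAdj-sym s₁ s₂ (inj₁ x) (inj₂ y) = refl
  sumAdj-sym s₁ s₂ (inj₂ x) (inj₁ y) = refl
  sumAdj-sym s₁ s₂ (inj₂ x) (inj₂ y) = s₂ x y

  sumAdj-irr : (∀ x → a₁ x x ≡ false) → (∀ x → a₂ x x ≡ false) →
               ∀ p → sumAdj p p ≡ false
  sumAdj-irr i₁ i₂ (inj₁ x) = i₁ x
  sumAdj-irr i₁ i₂ (inj₂ x) = i₂ x

_∪_ : Graph → Graph → Graph
G ∪ H = record
  { size = size G + size H
  ; adj = λ u v → sumAdj (adj G) (adj H) (splitAt (size G) u) (splitAt (size G) v)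
  ; sym = λ u v → sumAdj-sym (adj G) (adj H) (sym G) (sym H) (splitAt (size G) u) (splitAt (size G) v)
  ; irrefl = λ u → sumAdj-irr (adj G) (adj H) (irrefl G) (irrefl H) (splitAt (size G) u)
  }

Class : Set₁
Class = Graph → Set

Ind : Class → Class
Ind A H = ∃ λ G → A G × InducedSub H G

Hereditary : Class → Set
Hereditary F = ∀ G H → F G → InducedSub H G → F H

ChiNLe : ℕ → Graph → ℕ → Set
ChiNLe n G m = ∀ H → InducedSub H G → OmegaLe H n → ChiLe H m

Good : ℕ → Class → Set
Good n F = Hereditary F × ∃ λ m → ∀ G → F G → ChiNLe n G m

{-# OPTIONS --safe #-}
-- An induced subgraph H of G_m ∪ T splits into its part H₁ inside G_m and its part
-- inside T, with no edges in between.  If ω(H) ≤ r − 1 then ω(H₁) ≤ r − 1, so H₁ is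
-- B-colourable by hypothesis, while the other part is r-colourable because T is;
-- colouring the two parts from disjoint palettes gives χ(H) ≤ B + r, uniformly in m.
-- Heredity of an Ind-class is transitivity of induced embeddings.
module Submission where

open import Defs hiding (sym)
open import Data.Bool using (Bool; true)
open import Data.Empty using (⊥-elim)
open import Data.Fin using (Fin; zero; suc; splitAt; join)
open import Data.Fin.Properties using (splitAt-join; join-splitAt)
open import Data.List using (List; length; lookup; filter; allFin)
open import Data.List.Membership.Propositional.Properties using (∈-lookup; ∈-allFin; ∈-filter⁺)
import Data.List.Relation.Unary.All as All
open import Data.List.Relation.Unary.AllPairs using (_∷_)
open import Data.List.Relation.Unary.All.Properties using (all-filter)
open import Data.List.Relation.Unary.Any using (index)
open import Data.List.Relation.Unary.Any.Properties using (lookup-index)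
open import Data.List.Relation.Unary.Unique.Propositional using (Unique)
open import Data.List.Relation.Unary.Unique.Propositional.Properties using (allFin⁺; filter⁺)
open import Data.Nat using (ℕ; _+_; _≤_; _∸_)
open import Data.Product using (Σ; ∃; _×_; _,_; proj₁; proj₂)
open import Data.Sum using (_⊎_; inj₁; inj₂; map; map₁)
open import Data.Sum.Properties using (inj₁-injective; inj₂-injective)
open import Function using (_∘_)
open import Level using (0ℓ)
open import Relation.Binary.PropositionalEquality
  using (_≡_; _≢_; refl; sym; trans; cong; cong₂; module ≡-Reasoning)
open import Relation.Nullary using (yes; no)
open import Relation.Unary using (Pred; Decidable)

splitAt-injective : ∀ m {n} {i j : Fin (m + n)} → splitAt m i ≡ splitAt m j → i ≡ j
splitAt-injective m {n} {i} {j} eq = begin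
  i                       ≡⟨ join-splitAt m n i ⟨
  join m n (splitAt m i)  ≡⟨ cong (join m n) eq ⟩
  join m n (splitAt m j)  ≡⟨ join-splitAt m n j ⟩
  j                       ∎
  where open ≡-Reasoning

join-injective : ∀ m n {p q : Fin m ⊎ Fin n} → join m n p ≡ join m n q → p ≡ q
join-injective m n {p} {q} eq = begin
  p                       ≡⟨ splitAt-join m n p ⟨
  splitAt m (join m n p)  ≡⟨ cong (splitAt m) eq ⟩
  splitAt m (join m n q)  ≡⟨ splitAt-join m n q ⟩
  q                       ∎
  where open ≡-Reasoning

lookup-injective : ∀ {A : Set} {xs : List A} → Unique xs →
                   ∀ {i j} → lookup xs i ≡ lookup xs j → i ≡ j
lookup-injective (_  ∷ _) {zero}  {zero}  _  = refl
lookup-injective (x≢ ∷ _) {zero}  {suc j} eq = ⊥-elim (All.lookup x≢ (∈-lookup j) eq)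
lookup-injective (x≢ ∷ _) {suc i} {zero}  eq = ⊥-elim (All.lookup x≢ (∈-lookup i) (sym eq))
lookup-injective (_  ∷ u) {suc i} {suc j} eq = cong suc (lookup-injective u eq)

record Enumeration {n : ℕ} (P : Pred (Fin n) 0ℓ) : Set where
  field
    count             : ℕ
    element           : Fin count → Fin n
    element-injective : ∀ {i j} → element i ≡ element j → i ≡ j
    element-sound     : ∀ j → P (element j)
    position          : ∀ {i} → P i → Fin count
    element-position  : ∀ {i} (p : P i) → element (position p) ≡ i

enumerate : ∀ {n} {P : Pred (Fin n) 0ℓ} → Decidable P → Enumeration P
enumerate {n} P? = record
  { count             = length xs
  ; element           = lookup xs
  ; element-injective = lookup-injective (filter⁺ P? (allFin⁺ n))
  ; element-sound     = λ j → All.lookup (all-filter P? (allFin n)) (∈-lookup j)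
  ; position          = λ p → index (∈-filter⁺ P? (∈-allFin _) p)
  ; element-position  = λ p → sym (lookup-index (∈-filter⁺ P? (∈-allFin _) p))
  }
  where
  xs : List (Fin n)
  xs = filter P? (allFin n)

InducedSub-trans : ∀ {F G H} → InducedSub F G → InducedSub G H → InducedSub F H
InducedSub-trans (f , f-inj , f-adj) (g , g-inj , g-adj) =
  g ∘ f , (λ u v → f-inj u v ∘ g-inj (f u) (f v)) , (λ u v → trans (f-adj u v) (g-adj (f u) (f v)))

Ind-hereditary : (A : Class) → Hereditary (Ind A)
Ind-hereditary A G H (X , AX , G↪X) H↪G = X , AX , InducedSub-trans {H} {G} {X} H↪G G↪X

OmegaLe-induced : ∀ {H G n} → InducedSub H G → OmegaLe G n → OmegaLe H n
OmegaLe-induced (f , _ , f-adj) ω≤n (c , clique) =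
  ω≤n (f ∘ c , λ i j i≢j → trans (sym (f-adj (c i) (c j))) (clique i j i≢j))

Colorable-induced : ∀ {H G k} → InducedSub H G → Colorable G k → Colorable H k
Colorable-induced (f , _ , f-adj) (c , proper) =
  c ∘ f , λ u v uv → proper (f u) (f v) (trans (sym (f-adj u v)) uv)

_[_] : (G : Graph) {P : Pred (Vertex G) 0ℓ} → Decidable P → Graph
G [ P? ] = record
  { size   = count
  ; adj    = λ i j → adj G (element i) (element j)
  ; sym    = λ i j → Graph.sym G (element i) (element j)
  ; irrefl = λ i → irrefl G (element i)
  }
  where open Enumeration (enumerate P?)

[]-induced : (G : Graph) {P : Pred (Vertex G) 0ℓ} (P? : Decidable P) → InducedSub (G [ P? ]) G
[]-induced G P? = element , (λ _ _ → element-injective) , (λ _ _ → refl)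
  where open Enumeration (enumerate P?)

record InducedSub⊎ (H G₁ G₂ : Graph) : Set where
  field
    side           : Vertex H → Vertex G₁ ⊎ Vertex G₂
    side-injective : ∀ u v → side u ≡ side v → u ≡ v
    side-adj       : ∀ u v → adj H u v ≡ sumAdj (adj G₁) (adj G₂) (side u) (side v)

InducedSub⇒InducedSub⊎ : ∀ {H G₁ G₂} → InducedSub H (G₁ ∪ G₂) → InducedSub⊎ H G₁ G₂
InducedSub⇒InducedSub⊎ {G₁ = G₁} (φ , φ-inj , φ-adj) = record
  { side           = splitAt (size G₁) ∘ φ
  ; side-injective = λ u v → φ-inj u v ∘ splitAt-injective (size G₁)
  ; side-adj       = φ-adj
  }

InducedSub⊎⇒InducedSub : ∀ {H G₁ G₂} → InducedSub⊎ H G₁ G₂ → InducedSub H (G₁ ∪ G₂)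
InducedSub⊎⇒InducedSub {H} {G₁} {G₂} H↪G₁⊎G₂ =
  join n₁ n₂ ∘ side , (λ u v → side-injective u v ∘ join-injective n₁ n₂) , adj-join
  where
  open InducedSub⊎ H↪G₁⊎G₂
  n₁ = size G₁
  n₂ = size G₂
  adj-join : ∀ u v → adj H u v ≡ adj (G₁ ∪ G₂) (join n₁ n₂ (side u)) (join n₁ n₂ (side v))
  adj-join u v rewrite splitAt-join n₁ n₂ (side u) | splitAt-join n₁ n₂ (side v) = side-adj u v

Colorable-∪ : ∀ {G H k l} → Colorable G k → Colorable H l → Colorable (G ∪ H) (k + l)
Colorable-∪ {G} {H} {k} {l} (c₁ , proper₁) (c₂ , proper₂) =
  join k l ∘ map c₁ c₂ ∘ splitAt (size G) ,
  λ u v uv → proper⊎ (splitAt (size G) u) (splitAt (size G) v) uv ∘ join-injective k l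
  where
  proper⊎ : ∀ p q → sumAdj (adj G) (adj H) p q ≡ true → map c₁ c₂ p ≢ map c₁ c₂ q
  proper⊎ (inj₁ x) (inj₁ y) xy = proper₁ x y xy ∘ inj₁-injective
  proper⊎ (inj₂ x) (inj₂ y) xy = proper₂ x y xy ∘ inj₂-injective

sumAdj-map₁ : ∀ {k n₁ n₂} {b : Fin k → Fin k → Bool} {a₁ : Fin n₁ → Fin n₁ → Bool}
              (a₂ : Fin n₂ → Fin n₂ → Bool) (f : Fin k → Fin n₁) →
              (∀ i j → b i j ≡ a₁ (f i) (f j)) →
              ∀ p q → sumAdj a₁ a₂ (map₁ f p) (map₁ f q) ≡ sumAdj b a₂ p q
sumAdj-map₁ a₂ f b≡a₁ (inj₁ i) (inj₁ j) = sym (b≡a₁ i j)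
sumAdj-map₁ a₂ f b≡a₁ (inj₁ i) (inj₂ y) = refl
sumAdj-map₁ a₂ f b≡a₁ (inj₂ x) (inj₁ j) = refl
sumAdj-map₁ a₂ f b≡a₁ (inj₂ x) (inj₂ y) = refl

module LeftPart {H G₁ G₂ : Graph} (H↪G₁⊎G₂ : InducedSub⊎ H G₁ G₂) where

  open InducedSub⊎ H↪G₁⊎G₂

  IsLeft : Pred (Vertex H) 0ℓ
  IsLeft v = ∃ λ x → side v ≡ inj₁ x

  isLeft? : Decidable IsLeft
  isLeft? v with side v
  ... | inj₁ x = yes (x , refl)
  ... | inj₂ y = no λ { (_ , ()) }

  leftPart : Graph
  leftPart = H [ isLeft? ]

  leftPart↪H : InducedSub leftPart H
  leftPart↪H = []-induced H isLeft?

  open Enumeration (enumerate isLeft?)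

  toG₁ : Vertex leftPart → Vertex G₁
  toG₁ j = proj₁ (element-sound j)

  side-element : ∀ j → side (element j) ≡ inj₁ (toG₁ j)
  side-element j = proj₂ (element-sound j)

  leftPart↪G₁ : InducedSub leftPart G₁
  leftPart↪G₁ = toG₁ , toG₁-injective , toG₁-adj
    where
    toG₁-injective : ∀ i j → toG₁ i ≡ toG₁ j → i ≡ j
    toG₁-injective i j eq = element-injective (side-injective _ _
      (trans (side-element i) (trans (cong inj₁ eq) (sym (side-element j)))))
    toG₁-adj : ∀ i j → adj leftPart i j ≡ adj G₁ (toG₁ i) (toG₁ j)
    toG₁-adj i j = trans (side-adj _ _)
      (cong₂ (sumAdj (adj G₁) (adj G₂)) (side-element i) (side-element j))

  lift-side : ∀ v → Σ (Vertex leftPart ⊎ Vertex G₂) λ w → map₁ toG₁ w ≡ side v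
  lift-side v with side v in eq
  ... | inj₁ x = inj₁ (position (x , eq)) ,
                 trans (sym (side-element _)) (trans (cong side (element-position (x , eq))) eq)
  ... | inj₂ y = inj₂ y , refl

  H↪leftPart⊎G₂ : InducedSub⊎ H leftPart G₂
  H↪leftPart⊎G₂ = record
    { side           = relabel
    ; side-injective = relabel-injective
    ; side-adj       = relabel-adj
    }
    where
    relabel : Vertex H → Vertex leftPart ⊎ Vertex G₂
    relabel = proj₁ ∘ lift-side
    relabel-lifts : ∀ v → map₁ toG₁ (relabel v) ≡ side v
    relabel-lifts = proj₂ ∘ lift-side
    relabel-injective : ∀ u v → relabel u ≡ relabel v → u ≡ v
    relabel-injective u v eq = side-injective u v
      (trans (sym (relabel-lifts u)) (trans (cong (map₁ toG₁) eq) (relabel-lifts v)))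
    relabel-adj : ∀ u v → adj H u v ≡ sumAdj (adj leftPart) (adj G₂) (relabel u) (relabel v)
    relabel-adj u v = begin
      adj H u v
        ≡⟨ side-adj u v ⟩
      sumAdj (adj G₁) (adj G₂) (side u) (side v)
        ≡⟨ cong₂ (sumAdj (adj G₁) (adj G₂)) (relabel-lifts u) (relabel-lifts v) ⟨
      sumAdj (adj G₁) (adj G₂) (map₁ toG₁ (relabel u)) (map₁ toG₁ (relabel v))
        ≡⟨ sumAdj-map₁ (adj G₂) toG₁ (proj₂ (proj₂ leftPart↪G₁)) (relabel u) (relabel v) ⟩
      sumAdj (adj leftPart) (adj G₂) (relabel u) (relabel v)
        ∎
      where open ≡-Reasoning

lemma3p3 : (r : ℕ) → 2 ≤ r →
    (B : ℕ) (G : ℕ → Graph) (T : Graph) →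
    (∀ m → 1 ≤ m →
       OmegaEq (G m) r × ChiGe (G m) m ×
       (∀ H → InducedSub H (G m) → OmegaLe H (r ∸ 1) → ChiLe H B)) →
    Connected T → TriangleFree T → OmegaEq T 2 → ChiEq T r →
    Good (r ∸ 1) (Ind (λ X → ∃ λ m → 1 ≤ m × X ≡ (G m ∪ T)))
-- Only the bound B on the G_m side and χ(T) ≤ r are needed.
lemma3p3 r _ B G T hyp _ _ _ (χT≤r , _) = Ind-hereditary 𝒞 , B + r , χ⁽ʳ⁻¹⁾≤B+r
  where
  𝒞 : Class
  𝒞 X = ∃ λ m → 1 ≤ m × X ≡ (G m ∪ T)

  χ⁽ʳ⁻¹⁾≤B+r : ∀ X → Ind 𝒞 X → ChiNLe (r ∸ 1) X (B + r)
  χ⁽ʳ⁻¹⁾≤B+r X (_ , (m , m≥1 , refl) , X↪Gm∪T) H H↪X ω≤r-1 =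
    Colorable-induced {H} {leftPart ∪ T} (InducedSub⊎⇒InducedSub H↪leftPart⊎G₂)
      (Colorable-∪ {leftPart} {T} χleftPart≤B χT≤r)
    where
    H↪Gm∪T : InducedSub H (G m ∪ T)
    H↪Gm∪T = InducedSub-trans {H} {X} {G m ∪ T} H↪X X↪Gm∪T
    open LeftPart (InducedSub⇒InducedSub⊎ {H} {G m} {T} H↪Gm∪T)
    χleftPart≤B : ChiLe leftPart B
    χleftPart≤B = proj₂ (proj₂ (hyp m m≥1)) leftPart leftPart↪G₁
      (OmegaLe-induced {leftPart} {H} leftPart↪H ω≤r-1)
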